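{- Let $\mathcal{I}$ be an inference system (over a set $\mathcal{S}$ of propositions) which is finite in conclusions and has a complement $\mathcal{J}$. Then, for every proposition $A \in \mathcal{S}$, either the sequent $\vdash A$ has a finite proof in the complementation $\mathcal{I}_{\mathcal{J}}$, or the sequent $\not\vdash A$ has a (possibly infinite) proof in $\mathcal{I}_{\mathcal{J}}$. Thus the system $\mathcal{I}_{\mathcal{J}}$ is complete.
   Context: Let $\mathcal{S}$ be a set whose elements are called propositions. An inference rule is a partial function $f$ from $\mathcal{S}^n$ to $\mathcal{S}$ for some natural number $n$ (its number of premises); a proposition $B$ is derivable from the sequence $\langle A_1,\dots,A_n\rangle$ with $f$ if $\langle A_1,\dots,A_n\rangle$ is in the domain of $f$ and $f(A_1,\dots,A_n)=B$. An inference system is a set of inference rules. It is finite in conclusions if for each proposition $B$ there are only finitely many sequences of propositions from which $B$ can be derived with a rule of the system. A (possibly infinite) proof in an inference system is a (possibly infinite) tree labeled with propositions such that whenever a node is labeled $B$ and its children are labeled $A_1,\dots,A_n$ (in order), $B$ is derivable from $\langle A_1,\dots,A_n\rangle$ with a rule of the system; it is a proof of $A$ if its root is labeled $A$, and a finite proof if the tree is finite. Complement: let $\mathcal{I}$ be finite in conclusions. An inference system $\mathcal{J}$ is a complement of $\mathcal{I}$ if $\mathcal{J}$ is finite in conclusions and, for each proposition $B$, if $\langle A^1_1,\dots,A^1_{n_1}\rangle,\dots,\langle A^p_1,\dots,A^p_{n_p}\rangle$ are all the sequences from which $B$ is derivable with a rule of $\mathcal{I}$, then the sequences from which $B$ is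 derivable with a rule of $\mathcal{J}$ are exactly the sequences $\langle A^1_{j_1},\dots,A^p_{j_p}\rangle$ with $1\le j_i\le n_i$ for each $i$. Complementation: let $\mathcal{S}'$ be the set of sequents $\vdash A$ and $\not\vdash A$ for $A\in\mathcal{S}$. The inference system $\mathcal{I}_{\mathcal{J}}$ on $\mathcal{S}'$ consists of, for each rule $f$ of $\mathcal{I}$, the rule mapping $\vdash A_1,\dots,\vdash A_n$ to $\vdash f(A_1,\dots,A_n)$, and for each rule $f$ of $\mathcal{J}$, the rule mapping $\not\vdash A_1,\dots,\not\vdash A_n$ to $\not\vdash f(A_1,\dots,A_n)$ (on the same domains). -}

module Defs where

open import Data.Nat using (ℕ)
open import Data.List using (List; []; _∷_; length; map)
open import Data.Vec using (Vec; fromList)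
open import Data.Vec as Vec using ()
open import Data.List.Membership.Propositional using (_∈_)
open import Data.List.Relation.Unary.All using (All)
open import Data.List.Relation.Unary.Unique.Propositional using (Unique)
open import Data.Product using (Σ; Σ-syntax; _×_; ∃)
open import Data.Sum using (_⊎_; inj₁; inj₂)
open import Function.Bundles using (_⇔_)
open import Relation.Binary.PropositionalEquality using (_≡_; subst)

-- An inference rule: a partial function from S^n to S
-- (domain `Dom`, value `apply` on the domain).
record InferenceRule (S : Set) : Set₁ where
  field
    arity : ℕ
    Dom   : Vec S arity → Set
    apply : (v : Vec S arity) → Dom v → S
open InferenceRule public

record InferenceSystem (S : Set) : Set₁ where
  field
    Index : Set
    rule  : Index → InferenceRule S
open InferenceSystem public

Derivable : {S : Set} → InferenceSystem S → List S → S → Set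
Derivable {S} 𝓘 As B =
  Σ[ i ∈ Index 𝓘 ] Σ[ eq ∈ length As ≡ arity (rule 𝓘 i) ]
    Σ[ d ∈ Dom (rule 𝓘 i) (subst (Vec S) eq (fromList As)) ]
      apply (rule 𝓘 i) (subst (Vec S) eq (fromList As)) d ≡ B

FiniteInConclusions : {S : Set} → InferenceSystem S → Set
FiniteInConclusions {S} 𝓘 =
  (B : S) → Σ[ L ∈ List (List S) ] ((As : List S) → Derivable 𝓘 As B → As ∈ L)

-- Choices L ws : ws = ⟨A¹_{j₁}, …, Aᵖ_{jₚ}⟩ where L = ⟨⟨A¹…⟩, …, ⟨Aᵖ…⟩⟩,
-- i.e. the i-th entry of ws is an element of the i-th sequence of L.
data Choices {S : Set} : List (List S) → List S → Set where
  []  : Choices [] []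
  _∷_ : {l : List S} {ls : List (List S)} {a : S} {as : List S} →
        a ∈ l → Choices ls as → Choices (l ∷ ls) (a ∷ as)

IsComplement : {S : Set} → InferenceSystem S → InferenceSystem S → Set
IsComplement {S} 𝓘 𝓙 =
  FiniteInConclusions 𝓙 ×
  ((B : S) → Σ[ L ∈ List (List S) ]
      (Unique L
       × ((As : List S) → (As ∈ L) ⇔ Derivable 𝓘 As B)
       × ((Ws : List S) → Derivable 𝓙 Ws B ⇔ Choices L Ws)))

data Sequent (S : Set) : Set where
  ⊢_ : S → Sequent S
  ⊬_ : S → Sequent S

posRule : {S : Set} → InferenceRule S → InferenceRule (Sequent S)
posRule {S} f = record
  { arity = arity f
  ; Dom   = λ v → Σ[ as ∈ Vec S (arity f) ] ((v ≡ Vec.map ⊢_ as) × Dom f as)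
  ; apply = λ { v (as , _ , d) → ⊢ apply f as d }
  }
  where open Data.Product using (_,_)

negRule : {S : Set} → InferenceRule S → InferenceRule (Sequent S)
negRule {S} f = record
  { arity = arity f
  ; Dom   = λ v → Σ[ as ∈ Vec S (arity f) ] ((v ≡ Vec.map ⊬_ as) × Dom f as)
  ; apply = λ { v (as , _ , d) → ⊬ apply f as d }
  }
  where open Data.Product using (_,_)

Complementation : {S : Set} → InferenceSystem S → InferenceSystem S →
                  InferenceSystem (Sequent S)
Complementation 𝓘 𝓙 = record
  { Index = Index 𝓘 ⊎ Index 𝓙
  ; rule  = λ { (inj₁ i) → posRule (rule 𝓘 i) ; (inj₂ j) → negRule (rule 𝓙 j) }
  }

data FiniteProof {S : Set} (𝓘 : InferenceSystem S) : S → Set where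
  node : {B : S} (As : List S) → Derivable 𝓘 As B →
         All (FiniteProof 𝓘) As → FiniteProof 𝓘 B

record Proof {S : Set} (𝓘 : InferenceSystem S) (A : S) : Set₁ where
  field
    Node      : Set
    root      : Node
    label     : Node → S
    children  : Node → List Node
    rootLabel : label root ≡ A
    valid     : (n : Node) → Derivable 𝓘 (map label (children n)) (label n)

-- If ⊢ A has no finite proof then, classically, each premise list from which
-- 𝓘 derives A contains a proposition without a finite proof. Choosing one from
-- each list yields exactly a premise list of a 𝓙-rule concluding A, so ⊬ A is
-- derived from sequents ⊬ A′ with A′ again unprovable. The unprovable
-- propositions are therefore the nodes of a (possibly infinite) proof of ⊬ A.
{-# OPTIONS --safe #-}
module Submission where

open import Defs
open import Data.Sum using (_⊎_; inj₁; inj₂)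
open import Level using (0ℓ)
open import Axiom.ExcludedMiddle using (ExcludedMiddle)
open import Data.Nat using (ℕ)
open import Data.List using (List; []; _∷_; length; map)
open import Data.List.Properties using (length-map; map-∘)
open import Data.List.Membership.Propositional using (find)
open import Data.List.Relation.Unary.Any using (Any)
open import Data.List.Relation.Unary.All as All using (All; []; _∷_)
open import Data.List.Relation.Unary.All.Properties using (¬All⇒Any¬; map⁺)
open import Data.Vec using (Vec; fromList; cast)
import Data.Vec as Vec
open import Data.Vec.Properties using (subst-is-cast; fromList-map; map-cast)
open import Data.Vec.Relation.Binary.Equality.Cast using (cast-trans)
open import Data.Product using (Σ; Σ-syntax; _,_; proj₁; proj₂)
open import Function using (_∘_)
open import Function.Bundles using (Equivalence)
open import Relation.Binary.PropositionalEquality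
open import Relation.Nullary using (¬_; yes; no)

subst-fromList-map : {A B : Set} {n : ℕ} (c : A → B) (xs : List A)
  (eq : length xs ≡ n) →
  subst (Vec B) (trans (length-map c xs) eq) (fromList (map c xs))
    ≡ Vec.map c (subst (Vec A) eq (fromList xs))
subst-fromList-map {B = B} c xs eq = begin
  subst (Vec B) (trans (length-map c xs) eq) (fromList (map c xs))
    ≡⟨ subst-is-cast _ _ ⟩
  cast (trans (length-map c xs) eq) (fromList (map c xs))
    ≡⟨ cast-trans (length-map c xs) eq _ ⟨
  cast eq (cast (length-map c xs) (fromList (map c xs)))
    ≡⟨ cong (cast eq) (fromList-map c xs) ⟩
  cast eq (Vec.map c (fromList xs))
    ≡⟨ map-cast c eq (fromList xs) ⟨
  Vec.map c (cast eq (fromList xs))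
    ≡⟨ cong (Vec.map c) (subst-is-cast eq (fromList xs)) ⟨
  Vec.map c (subst (Vec _) eq (fromList xs))
    ∎
  where open ≡-Reasoning

choices : {A : Set} {P : A → Set} (L : List (List A)) → All (Any P) L →
  Σ[ cs ∈ List (Σ A P) ] Choices L (map proj₁ cs)
choices []      []         = [] , []
choices (l ∷ L) (pl ∷ pL) with find pl | choices L pL
... | a , a∈l , pa | cs , ch = (a , pa) ∷ cs , a∈l ∷ ch

module _ {S : Set} (𝓘 𝓙 : InferenceSystem S) where

  private
    𝓘𝓙 : InferenceSystem (Sequent S)
    𝓘𝓙 = Complementation 𝓘 𝓙

  ⊢-derivable : {As : List S} {B : S} →
    Derivable 𝓘 As B → Derivable 𝓘𝓙 (map ⊢_ As) (⊢ B)
  ⊢-derivable {As} (i , eq , d , refl) =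
    inj₁ i , _ , (_ , subst-fromList-map ⊢_ As eq , d) , refl

  ⊬-derivable : {As : List S} {B : S} →
    Derivable 𝓙 As B → Derivable 𝓘𝓙 (map ⊬_ As) (⊬ B)
  ⊬-derivable {As} (j , eq , d , refl) =
    inj₂ j , _ , (_ , subst-fromList-map ⊬_ As eq , d) , refl

  Unprovable : S → Set
  Unprovable A = ¬ FiniteProof 𝓘𝓙 (⊢ A)

  unprovable-premise : ExcludedMiddle 0ℓ → {As : List S} {B : S} →
    Derivable 𝓘 As B → Unprovable B → Any Unprovable As
  unprovable-premise lem {As} der ¬⊢B = ¬All⇒Any¬ (λ _ → lem) As
    (λ ⊢As → ¬⊢B (node (map ⊢_ As) (⊢-derivable der) (map⁺ ⊢As)))

  unprovable-refutation-step : ExcludedMiddle 0ℓ → IsComplement 𝓘 𝓙 →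
    {B : S} → Unprovable B →
    Σ[ cs ∈ List (Σ S Unprovable) ] Derivable 𝓘𝓙 (map (⊬_ ∘ proj₁) cs) (⊬ B)
  unprovable-refutation-step lem (_ , complement) {B} ¬⊢B
    with complement B
  ... | L , _ , L⇔premises , choice⇔premises
    with choices L (All.tabulate λ {As} As∈L →
           unprovable-premise lem (Equivalence.to (L⇔premises As) As∈L) ¬⊢B)
  ... | cs , ch =
    cs , subst (λ Ws → Derivable 𝓘𝓙 Ws (⊬ B)) (sym (map-∘ cs))
           (⊬-derivable (Equivalence.from (choice⇔premises _) ch))

theorem1 : ExcludedMiddle 0ℓ →
    (S : Set) (𝓘 𝓙 : InferenceSystem S) →
    FiniteInConclusions 𝓘 → IsComplement 𝓘 𝓙 →
    (A : S) →
    FiniteProof (Complementation 𝓘 𝓙) (⊢ A) ⊎ Proof (Complementation 𝓘 𝓙) (⊬ A)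
theorem1 lem S 𝓘 𝓙 _ complement A with lem {FiniteProof (Complementation 𝓘 𝓙) (⊢ A)}
... | yes ⊢A = inj₁ ⊢A
... | no ¬⊢A = inj₂ record
  { Node      = Σ S (Unprovable 𝓘 𝓙)
  ; root      = A , ¬⊢A
  ; label     = ⊬_ ∘ proj₁
  ; children  = λ (_ , ¬⊢B) → proj₁ (unprovable-refutation-step 𝓘 𝓙 lem complement ¬⊢B)
  ; rootLabel = refl
  ; valid     = λ (_ , ¬⊢B) → proj₂ (unprovable-refutation-step 𝓘 𝓙 lem complement ¬⊢B)
  }
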